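{- If $G$ is a finite, simple, connected graph, then ${\rm mdim}(G)\ge \dim(M(G))$.
   Context: For a connected graph $H$, $d_H$ is the usual distance; for a vertex $v$ and an edge $e=ww'$, $d_H(e,v)=\min\{d_H(w,v),d_H(w',v)\}$. A set $S\subseteq V(H)$ is a resolving set if every two distinct vertices $x,y$ satisfy $d_H(x,v)\ne d_H(y,v)$ for some $v\in S$, and a mixed resolving set if the same holds for every two distinct elements of $V(H)\cup E(H)$; $\dim(H)$ and ${\rm mdim}(H)$ are the minimum cardinalities of a resolving set and of a mixed resolving set. The middle graph $M(G)$ is obtained from $G$ by subdividing each edge $e$ with a new vertex $v_e$ (the original edges being replaced by the two halves), and then joining $v_e$ and $v_f$ whenever the edges $e,f$ of $G$ share an endvertex. -}

module Defs where

open import Data.Nat using (ℕ; zero; suc; _≤_; _⊓_)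
open import Data.Fin using (Fin) renaming (_<_ to _<ᶠ_)
open import Data.Bool using (Bool; true)
open import Data.Sum using (_⊎_; inj₁; inj₂)
open import Data.Product using (Σ; ∃; ∃-syntax; _×_; _,_)
open import Data.Empty using (⊥)
open import Data.List using (List; length)
open import Data.List.Membership.Propositional using (_∈_)
open import Data.List.Relation.Unary.Unique.Propositional using (Unique)
open import Relation.Binary.PropositionalEquality using (_≡_; _≢_)

record Graph : Set₁ where
  field
    V   : Set
    Adj : V → V → Set

open Graph public

data Walk (H : Graph) : V H → V H → ℕ → Set where
  nil  : ∀ {u} → Walk H u u 0
  cons : ∀ {u w v k} → Adj H u w → Walk H w v k → Walk H u v (suc k)

Connected : Graph → Set
Connected H = ∀ (u v : V H) → ∃[ k ] Walk H u v k

IsDist : (H : Graph) → V H → V H → ℕ → Set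
IsDist H u v k = Walk H u v k × (∀ m → Walk H u v m → k ≤ m)

-- Resolving sets w.r.t. an arbitrary "distance relation" D from a set of
-- elements X to the vertices.  Sets are duplicate-free lists; the
-- cardinality is the length.

Resolves : {X W : Set} → (X → W → ℕ → Set) → List W → X → X → Set
Resolves {W = W} D S x y =
  Σ W λ v → v ∈ S × ∃[ a ] ∃[ b ] (D x v a × D y v b × a ≢ b)

IsResolvingFor : {X W : Set} → (X → W → ℕ → Set) → List W → Set
IsResolvingFor {X} D S = ∀ (x y : X) → x ≢ y → Resolves D S x y

IsMinResolving : {X W : Set} → (X → W → ℕ → Set) → ℕ → Set
IsMinResolving {W = W} D k =
  (Σ (List W) λ S → Unique S × length S ≡ k × IsResolvingFor D S)
  × (∀ (S : List W) → Unique S → IsResolvingFor D S → k ≤ length S)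

IsDim : Graph → ℕ → Set
IsDim H k = IsMinResolving (IsDist H) k

record SimpleGraph (n : ℕ) : Set where
  field
    adj     : Fin n → Fin n → Bool
    adj-sym : ∀ i j → adj i j ≡ adj j i
    irrefl  : ∀ i → adj i i ≡ true → ⊥

open SimpleGraph public

toGraph : ∀ {n} → SimpleGraph n → Graph
toGraph {n} G = record { V = Fin n ; Adj = λ i j → adj G i j ≡ true }

-- An edge {u,v} of G, normalised so that u < v.  Proof fields are
-- irrelevant, so edges are equal iff their endpoints are.
record Edge {n : ℕ} (G : SimpleGraph n) : Set where
  constructor edge
  field
    end₁  : Fin n
    end₂  : Fin n
    .ord  : end₁ <ᶠ end₂
    .isE  : adj G end₁ end₂ ≡ true

open Edge public

Elem : ∀ {n} → SimpleGraph n → Set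
Elem {n} G = Fin n ⊎ Edge G

ElemDist : ∀ {n} (G : SimpleGraph n) → Elem G → Fin n → ℕ → Set
ElemDist G (inj₁ w) v k = IsDist (toGraph G) w v k
ElemDist G (inj₂ e) v k =
  ∃[ a ] ∃[ b ] (IsDist (toGraph G) (end₁ e) v a
               × IsDist (toGraph G) (end₂ e) v b
               × k ≡ a ⊓ b)

IsMDim : ∀ {n} → SimpleGraph n → ℕ → Set
IsMDim G k = IsMinResolving (ElemDist G) k

IsEnd : ∀ {n} {G : SimpleGraph n} → Fin n → Edge G → Set
IsEnd w e = (w ≡ end₁ e) ⊎ (w ≡ end₂ e)

ShareEnd : ∀ {n} {G : SimpleGraph n} → Edge G → Edge G → Set
ShareEnd {n} e f = Σ (Fin n) λ w → IsEnd w e × IsEnd w f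

MAdj : ∀ {n} (G : SimpleGraph n) → Elem G → Elem G → Set
MAdj G (inj₁ a) (inj₁ b) = ⊥
MAdj G (inj₁ a) (inj₂ e) = IsEnd a e
MAdj G (inj₂ e) (inj₁ a) = IsEnd a e
MAdj G (inj₂ e) (inj₂ f) = e ≢ f × ShareEnd e f

Middle : ∀ {n} → SimpleGraph n → Graph
Middle G = record { V = Elem G ; Adj = MAdj G }

{-# OPTIONS --safe #-}
-- Every vertex v of G is also a vertex of M(G), and a G-walk of length k
-- becomes an M(G)-walk through the middle vertices of its edges.  This gives
-- d_M(w,v) = 0 for w = v and d_G(w,v) + 1 otherwise, and d_M(v_e,v) =
-- d_G(e,v) + 1.  Both recodings are injective on the pair (kind, distance)
-- — a vertex code k+1 is met by an edge code only at the same distance k —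
-- so a mixed resolving set of G, read in M(G), resolves V(M(G)) = V(G) ∪ E(G).
module Submission where

open import Defs
open import Data.Nat using (ℕ; zero; suc; _≤_; _⊓_; z≤n; s≤s)
open import Data.Nat.Properties
  using (suc-injective; n≤1+n; ≤-antisym; ≤-trans; ≤-refl; m≤n⇒m≤1+n;
         m⊓n≤m; m⊓n≤n; m≤n⇒m⊓n≡m; m≥n⇒m⊓n≡n; ≤-total)
open import Data.Fin using (Fin)
open import Data.Fin.Properties using (<-cmp) renaming (_≟_ to _≟ᶠ_)
open import Data.Bool using (true)
open import Data.Bool.Properties using () renaming (_≟_ to _≟ᵇ_)
open import Data.Sum using (_⊎_; inj₁; inj₂)
open import Data.Sum.Properties using (inj₁-injective)
open import Data.Product using (Σ; ∃-syntax; _×_; _,_)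
open import Data.Empty using (⊥-elim)
open import Data.List using (map)
open import Data.List.Properties using (length-map)
open import Data.List.Membership.Propositional.Properties using (∈-map⁺)
import Data.List.Relation.Unary.Unique.Propositional.Properties as Unique
open import Relation.Nullary using (yes; no)
open import Relation.Nullary.Decidable using (recompute)
open import Relation.Binary.Definitions using (DecidableEquality; tri<; tri≈; tri>)
open import Relation.Binary.PropositionalEquality

module _ {X W W′ : Set} {D : X → W → ℕ → Set} {D′ : X → W′ → ℕ → Set}
         (f : W → W′) (recode : X → ℕ → ℕ)
         (recode-injective : ∀ x y {a b} → recode x a ≡ recode y b → a ≡ b)
         (transport : ∀ x {v k} → D x v k → D′ x (f v) (recode x k)) where

  resolves-map : ∀ {S x y} → Resolves D S x y → Resolves D′ (map f S) x y
  resolves-map {x = x} {y} (v , v∈S , a , b , dx , dy , a≢b) =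
    f v , ∈-map⁺ f v∈S , recode x a , recode y b ,
    transport x dx , transport y dy , λ eq → a≢b (recode-injective x y eq)

  isResolvingFor-map : ∀ {S} → IsResolvingFor D S → IsResolvingFor D′ (map f S)
  isResolvingFor-map res x y x≢y = resolves-map (res x y x≢y)

  isMinResolving-mono : (∀ {v w} → f v ≡ f w → v ≡ w) → ∀ {m d} →
    IsMinResolving D m → IsMinResolving D′ d → d ≤ m
  isMinResolving-mono f-injective ((S , unique , refl , res) , _) (_ , minimal) =
    subst (_ ≤_) (length-map f S)
      (minimal (map f S) (Unique.map⁺ f-injective unique) (isResolvingFor-map res))

IsDist-intro : ∀ {H x y t} → (∃[ j ] (Walk H x y j × j ≤ t)) →
  (∀ m → Walk H x y m → t ≤ m) → IsDist H x y t
IsDist-intro (j , walk , j≤t) minimal =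
  subst (Walk _ _ _) (≤-antisym j≤t (minimal j walk)) walk , minimal

vertexDistᴹ : ℕ → ℕ
vertexDistᴹ zero    = zero
vertexDistᴹ (suc k) = suc (suc k)

vertexDistᴹ-mono-≤ : ∀ {a b} → a ≤ b → vertexDistᴹ a ≤ vertexDistᴹ b
vertexDistᴹ-mono-≤ {zero}  _       = z≤n
vertexDistᴹ-mono-≤ {suc a} (s≤s p) = s≤s (s≤s p)

n≤vertexDistᴹ : ∀ n → n ≤ vertexDistᴹ n
n≤vertexDistᴹ zero    = z≤n
n≤vertexDistᴹ (suc n) = s≤s (n≤1+n n)

vertexDistᴹ≤1+n : ∀ n → vertexDistᴹ n ≤ suc n
vertexDistᴹ≤1+n zero    = z≤n
vertexDistᴹ≤1+n (suc n) = ≤-refl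

vertexDistᴹ-injective : ∀ {a b} → vertexDistᴹ a ≡ vertexDistᴹ b → a ≡ b
vertexDistᴹ-injective {zero}  {zero}  _  = refl
vertexDistᴹ-injective {suc a} {suc b} eq = suc-injective eq

vertexDistᴹ≡suc⇒≡ : ∀ {a b} → vertexDistᴹ a ≡ suc b → a ≡ b
vertexDistᴹ≡suc⇒≡ {suc a} eq = suc-injective eq

module _ {n : ℕ} (G : SimpleGraph n) where

  private
    Gᵍ = toGraph G
    Mᵍ = Middle G

  elemDistᴹ : Elem G → ℕ → ℕ
  elemDistᴹ (inj₁ _) = vertexDistᴹ
  elemDistᴹ (inj₂ _) = suc

  elemDistᴹ-injective : ∀ x y {a b} → elemDistᴹ x a ≡ elemDistᴹ y b → a ≡ b
  elemDistᴹ-injective (inj₁ _) (inj₁ _) eq = vertexDistᴹ-injective eq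
  elemDistᴹ-injective (inj₁ _) (inj₂ _) eq = vertexDistᴹ≡suc⇒≡ eq
  elemDistᴹ-injective (inj₂ _) (inj₁ _) eq = sym (vertexDistᴹ≡suc⇒≡ (sym eq))
  elemDistᴹ-injective (inj₂ _) (inj₂ _) eq = suc-injective eq

  edge-adj : (e : Edge G) → adj G (end₁ e) (end₂ e) ≡ true
  edge-adj (edge a b _ p) = recompute (adj G a b ≟ᵇ true) p

  _≟ᴱ_ : DecidableEquality (Edge G)
  edge a b _ _ ≟ᴱ edge c d _ _ with a ≟ᶠ c | b ≟ᶠ d
  ... | yes refl | yes refl = yes refl
  ... | no a≢c   | _        = no λ { refl → a≢c refl }
  ... | yes _    | no b≢d   = no λ { refl → b≢d refl }

  adj⇒edge : ∀ {u w} → adj G u w ≡ true → Σ (Edge G) λ e → IsEnd u e × IsEnd w e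
  adj⇒edge {u} {w} p with <-cmp u w
  ... | tri< u<w _ _ = edge u w u<w p , inj₁ refl , inj₂ refl
  ... | tri≈ _ refl _ = ⊥-elim (irrefl G u p)
  ... | tri> _ _ w<u = edge w u w<u (trans (adj-sym G w u) p) , inj₂ refl , inj₁ refl

  ends⇒≡⊎adj : ∀ {u w} (e : Edge G) → IsEnd u e → IsEnd w e → u ≡ w ⊎ adj G u w ≡ true
  ends⇒≡⊎adj e (inj₁ refl) (inj₁ refl) = inj₁ refl
  ends⇒≡⊎adj e (inj₂ refl) (inj₂ refl) = inj₁ refl
  ends⇒≡⊎adj e (inj₁ refl) (inj₂ refl) = inj₂ (edge-adj e)
  ends⇒≡⊎adj e (inj₂ refl) (inj₁ refl) =
    inj₂ (trans (adj-sym G (end₂ e) (end₁ e)) (edge-adj e))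

  liftWalkᴱ : ∀ {u v k} {e : Edge G} → Walk Gᵍ u v k → IsEnd u e →
    ∃[ j ] (Walk Mᵍ (inj₂ e) (inj₁ v) j × j ≤ suc k)
  liftWalkᴱ nil u∈e = 1 , cons u∈e nil , ≤-refl
  liftWalkᴱ {e = e} (cons uw rest) u∈e with adj⇒edge uw
  ... | f , u∈f , w∈f with e ≟ᴱ f | liftWalkᴱ {e = f} rest w∈f
  ... | yes refl | j , walk , j≤ = j , walk , m≤n⇒m≤1+n j≤
  ... | no e≢f   | j , walk , j≤ = suc j , cons (e≢f , _ , u∈e , u∈f) walk , s≤s j≤

  liftWalkⱽ : ∀ {w v k} → Walk Gᵍ w v k →
    ∃[ j ] (Walk Mᵍ (inj₁ w) (inj₁ v) j × j ≤ vertexDistᴹ k)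
  liftWalkⱽ nil = 0 , nil , z≤n
  liftWalkⱽ (cons wu rest) with adj⇒edge wu
  ... | f , w∈f , u∈f with liftWalkᴱ {e = f} rest u∈f
  ... | j , walk , j≤ = suc j , cons w∈f walk , s≤s j≤

  -- The projection of an M(G)-walk of length m from x to v: a G-walk from x,
  -- or from an endpoint of the edge x, whose recoded length is at most m.
  ShadowWalk : Fin n → Elem G → ℕ → Set
  ShadowWalk v (inj₁ w) m = ∃[ k ] (Walk Gᵍ w v k × vertexDistᴹ k ≤ m)
  ShadowWalk v (inj₂ e) m =
    ∃[ u ] ∃[ k ] (IsEnd u e × Walk Gᵍ u v k × suc k ≤ m)

  shadow : ∀ {v x m} → Walk Mᵍ x (inj₁ v) m → ShadowWalk v x m
  shadow nil = 0 , nil , z≤n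
  shadow {x = inj₁ w} (cons {w = inj₂ e} w∈e rest) with shadow rest
  ... | u , k , u∈e , walk , k< with ends⇒≡⊎adj e w∈e u∈e
  ... | inj₁ refl = k , walk , m≤n⇒m≤1+n (≤-trans (vertexDistᴹ≤1+n k) k<)
  ... | inj₂ wu   = suc k , cons wu walk , s≤s k<
  shadow {x = inj₂ e} (cons {w = inj₁ w} w∈e rest) with shadow rest
  ... | k , walk , k≤ = w , k , w∈e , walk , s≤s (≤-trans (n≤vertexDistᴹ k) k≤)
  shadow {x = inj₂ e} (cons {w = inj₂ f} (_ , w , w∈e , w∈f) rest) with shadow rest
  ... | u , k , u∈f , walk , k< with ends⇒≡⊎adj f w∈f u∈f
  ... | inj₁ refl = w , k , w∈e , walk , m≤n⇒m≤1+n k<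
  ... | inj₂ wu   = w , suc k , w∈e , cons wu walk , s≤s k<

  vertexDist-middle : ∀ {w v a} → IsDist Gᵍ w v a →
    IsDist Mᵍ (inj₁ w) (inj₁ v) (vertexDistᴹ a)
  vertexDist-middle (walk , minimal) = IsDist-intro (liftWalkⱽ walk) λ m walkᴹ →
    let (k , walkᴳ , k≤) = shadow walkᴹ
    in  ≤-trans (vertexDistᴹ-mono-≤ (minimal k walkᴳ)) k≤

  edgeDist-middle : ∀ {e v a b} → IsDist Gᵍ (end₁ e) v a → IsDist Gᵍ (end₂ e) v b →
    IsDist Mᵍ (inj₂ e) (inj₁ v) (suc (a ⊓ b))
  edgeDist-middle {a = a} {b} (walk₁ , minimal₁) (walk₂ , minimal₂) =
    IsDist-intro lifted minimal
    where
    lifted : ∃[ j ] (Walk Mᵍ _ _ j × j ≤ suc (a ⊓ b))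
    lifted with ≤-total a b
    ... | inj₁ a≤b rewrite m≤n⇒m⊓n≡m a≤b = liftWalkᴱ walk₁ (inj₁ refl)
    ... | inj₂ b≤a rewrite m≥n⇒m⊓n≡n b≤a = liftWalkᴱ walk₂ (inj₂ refl)
    minimal : ∀ m → Walk Mᵍ _ _ m → suc (a ⊓ b) ≤ m
    minimal m walkᴹ with shadow walkᴹ
    ... | _ , k , inj₁ refl , walk , k< =
      ≤-trans (s≤s (≤-trans (m⊓n≤m a b) (minimal₁ k walk))) k<
    ... | _ , k , inj₂ refl , walk , k< =
      ≤-trans (s≤s (≤-trans (m⊓n≤n a b) (minimal₂ k walk))) k<

  elemDist-middle : ∀ x {v k} → ElemDist G x v k →
    IsDist Mᵍ x (inj₁ v) (elemDistᴹ x k)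
  elemDist-middle (inj₁ _) d = vertexDist-middle d
  elemDist-middle (inj₂ _) (_ , _ , d₁ , d₂ , refl) = edgeDist-middle d₁ d₂

theorem4p1 : ∀ (n : ℕ) (G : SimpleGraph n) → Connected (toGraph G)
           → ∀ (m d : ℕ) → IsMDim G m → IsDim (Middle G) d → d ≤ m
theorem4p1 n G _ m d mdim dim =
  isMinResolving-mono inj₁ (elemDistᴹ G) (elemDistᴹ-injective G)
    (elemDist-middle G) inj₁-injective mdim dim
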